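{- Let $S$ be a set of finite strings, no one a substring of another, and let $\mathcal{C}(S)$ be the cycle cover computed by MGREEDY with a fixed tie-breaking rule. Let $\overline{\mathcal{C}}\subseteq \mathcal{C}(S)$ be a set of cycles and let $\overline{S}\subseteq S$ be the set of strings lying on cycles of $\overline{\mathcal{C}}$. Then MGREEDY run on input $\overline{S}$ (with the same tie-breaking rule, i.e. the induced order on edges among $\overline{S}$) outputs exactly $\overline{\mathcal{C}}$; in particular $\overline{\mathcal{C}}$ is a minimum-length cycle cover of $G_{\mathrm{dist}}(\overline{S})$, i.e. $\mathcal{C}(\overline{S})=\overline{\mathcal{C}}$.
   Context: For strings $s\neq t$, $\mathrm{ov}(s,t)$ is the longest suffix of $s$ that is a prefix of $t$; $\mathrm{ov}(s,s)$ is the longest suffix of $s$ of length less than $|s|$ that is also a prefix of $s$. $\mathrm{dist}(s,t)=|s|-|\mathrm{ov}(s,t)|$. $G_{\mathrm{dist}}(S)$ is the complete directed graph with self-loops on vertex set $S$ with edge lengths $\mathrm{dist}$. A cycle cover is a set of vertex-disjoint directed cycles (self-loops allowed) covering all vertices. MGREEDY: sort all ordered pairs $(s,t)$ of $S$ (including $s=t$) by non-increasing $|\mathrm{ov}(s,t)|$ with a fixed tie-breaking rule, scan the list and add $(s,t)$ iff no previously added edge has tail $s$ or head $t$; the output is a cycle cover, denoted $\mathcal{C}(S)$, and it has minimum total length in $G_{\mathrm{dist}}(S)$. -}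

module Defs where

open import Data.Nat using (ℕ; zero; suc; _≤_; _∸_; _⊓_)
open import Data.Bool using (Bool; true; false; if_then_else_; _∧_; _∨_)
open import Data.List using (List; []; _∷_; _++_; length; take; drop; map; concatMap; filter)
open import Data.Bool.ListAction using (any)
open import Data.List.Relation.Unary.Linked using (Linked)
open import Data.List.Relation.Unary.Unique.Propositional using (Unique)
open import Data.List.Relation.Binary.Permutation.Propositional using (_↭_)
open import Data.List.Membership.Propositional using (_∈_)
open import Data.List.Properties using (≡-dec)
open import Data.Product using (_×_; _,_; proj₁; proj₂; Σ; ∃)
open import Data.Sum using (_⊎_)
open import Relation.Nullary using (¬_; does)
open import Relation.Binary.Definitions using (DecidableEquality)
open import Relation.Binary.PropositionalEquality using (_≡_; _≢_)

module Strings {A : Set} (_≟_ : DecidableEquality A) where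

  Str : Set
  Str = List A

  _≟s_ : DecidableEquality Str
  _≟s_ = ≡-dec _≟_

  Substring : Str → Str → Set
  Substring s t = Σ Str λ u → Σ Str λ v → t ≡ u ++ s ++ v

  SubstringFree : List Str → Set
  SubstringFree S = ∀ {s t} → s ∈ S → t ∈ S → s ≢ t → ¬ Substring s t

  sufPre : ℕ → Str → Str → Bool
  sufPre k s t =
    does (k Data.Nat.≤? length s) ∧ does (k Data.Nat.≤? length t)
      ∧ does (drop (length s ∸ k) s ≟s take k t)

  maxSat : (ℕ → Bool) → ℕ → ℕ
  maxSat p zero = zero
  maxSat p (suc n) = if p (suc n) then suc n else maxSat p n

  -- |ov(s,t)|: longest suffix of s that is a prefix of t; for s = t only
  -- suffixes of length < |s| are allowed.
  ovLen : Str → Str → ℕ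
  ovLen s t with does (s ≟s t)
  ... | true  = maxSat (λ k → sufPre k s t) (length s ∸ 1)
  ... | false = maxSat (λ k → sufPre k s t) (length s ⊓ length t)

  Edge : Set
  Edge = Str × Str

  tail head : Edge → Str
  tail = proj₁
  head = proj₂

  allPairs : List Str → List Edge
  allPairs S = concatMap (λ s → map (λ t → (s , t)) S) S

  -- an admissible MGREEDY edge order for S: a listing of all ordered pairs,
  -- sorted by non-increasing overlap length (the order among ties is the
  -- tie-breaking rule)
  IsMGreedyOrder : List Str → List Edge → Set
  IsMGreedyOrder S E =
    (E ↭ allPairs S) × Linked (λ e f → ovLen (tail f) (head f) ≤ ovLen (tail e) (head e)) E

  greedyScan : List Edge → List Edge → List Edge
  greedyScan acc [] = acc
  greedyScan acc ((s , t) ∷ es) =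
    if any (λ e → does (tail e ≟s s) ∨ does (head e ≟s t)) acc
    then greedyScan acc es
    else greedyScan (acc ++ ((s , t) ∷ [])) es

  mgreedy : List Edge → List Edge
  mgreedy = greedyScan []

  _∈?_ : Str → List Str → Bool
  s ∈? S = any (λ u → does (u ≟s s)) S

  restrictOrder : List Str → List Edge → List Edge
  restrictOrder S̄ E = filter (λ e → (tail e ∈? S̄) Data.Bool.≟ true Relation.Nullary.×-dec ((head e ∈? S̄) Data.Bool.≟ true)) E

  ShareEndpoint : Edge → Edge → Set
  ShareEndpoint e f =
    (tail e ≡ tail f) ⊎ (tail e ≡ head f) ⊎ (head e ≡ tail f) ⊎ (head e ≡ head f)

  -- C̄ (a set of edges) is a union of cycles of the cycle cover C:
  -- C̄ ⊆ C and C̄ is closed under taking edges of C adjacent to its edges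
  -- (in a cycle cover these are exactly the unions of whole cycles).
  UnionOfCycles : List Edge → List Edge → Set
  UnionOfCycles C C̄ =
    (∀ {e} → e ∈ C̄ → e ∈ C) ×
    (∀ {e f} → e ∈ C → f ∈ C̄ → ShareEndpoint e f → e ∈ C̄)

  VerticesOf : List Edge → List Str → Set
  VerticesOf C̄ S̄ = ∀ s → (s ∈ S̄ → ∃ λ t → ((s , t) ∈ C̄) ⊎ ((t , s) ∈ C̄))
                       × ((∃ λ t → ((s , t) ∈ C̄) ⊎ ((t , s) ∈ C̄)) → s ∈ S̄)

{-# OPTIONS --safe #-}
-- Whether MGREEDY accepts an edge depends only on the previously accepted
-- edges sharing its tail or its head. If such an edge lies on a cycle of C̄,
-- its endpoints are in S̄, so it lies on a cycle of C̄ itself. Hence, while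
-- scanning the induced order, the accepted edges are at every moment exactly
-- the edges among S̄ accepted so far by the full scan, and the outputs agree.
module Submission where

open import Defs
open import Data.Bool using (Bool; true; false; T; if_then_else_; _∨_)
open import Data.Bool.ListAction using (any)
open import Data.Bool.Properties using (if-float; if-cong; if-cong-else; if-eta)
open import Data.List using (List; []; _∷_; _++_; [_]; filter)
open import Data.List.Properties using (filter-accept; filter-reject; filter-++; ++-identityʳ)
open import Data.List.Relation.Unary.All as All using (All; []; _∷_)
open import Data.List.Relation.Unary.Any using (here; there)
open import Data.List.Relation.Unary.Unique.Propositional using (Unique)
open import Data.List.Membership.Propositional using (_∈_)
open import Data.List.Membership.Propositional.Properties using (∈-filter⁺; ∈-filter⁻; ∈-++⁺ˡ)
open import Data.Product using (_×_; _,_; proj₁; proj₂)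
open import Data.Sum using (_⊎_; inj₁; inj₂)
open import Relation.Nullary using (Dec; yes; no; does; ¬_; _×-dec_; contradiction)
open import Relation.Unary using (Decidable)
open import Relation.Binary.Definitions using (DecidableEquality)
open import Relation.Binary.PropositionalEquality using (_≡_; refl; sym; trans; cong; subst; module ≡-Reasoning)

module _ {X : Set} {P : X → Set} (P? : Decidable P) (p : X → Bool) where

  any-filter : ∀ {xs} → All (λ x → T (p x) → P x) xs → any p (filter P? xs) ≡ any p xs
  any-filter [] = refl
  any-filter {x ∷ xs} (px⇒Px ∷ rest) = by-cases (P? x)
    where
      open ≡-Reasoning
      by-cases : Dec (P x) → any p (filter P? (x ∷ xs)) ≡ p x ∨ any p xs
      by-cases (yes Px) = begin
        any p (filter P? (x ∷ xs)) ≡⟨ cong (any p) (filter-accept P? Px) ⟩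
        p x ∨ any p (filter P? xs) ≡⟨ cong (p x ∨_) (any-filter rest) ⟩
        p x ∨ any p xs             ∎
      by-cases (no ¬Px) = begin
        any p (filter P? (x ∷ xs)) ≡⟨ cong (any p) (filter-reject P? ¬Px) ⟩
        any p (filter P? xs)       ≡⟨ any-filter rest ⟩
        any p xs                   ≡⟨ cong (_∨ any p xs) (sym px≡false) ⟩
        p x ∨ any p xs             ∎
        where
          px≡false : p x ≡ false
          px≡false with p x
          ... | false = refl
          ... | true  = contradiction (px⇒Px _) ¬Px

module MGreedy {A : Set} (_≟_ : DecidableEquality A) where
  open Strings _≟_

  blockedBy? : Edge → Edge → Bool
  blockedBy? (s , t) x = does (tail x ≟s s) ∨ does (head x ≟s t)

  Blocks : Edge → Edge → Set
  Blocks x e = tail x ≡ tail e ⊎ head x ≡ head e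

  blockedBy?-sound : ∀ e x → T (blockedBy? e x) → Blocks x e
  blockedBy?-sound (s , t) (u , v) with u ≟s s | v ≟s t
  ... | yes u≡s | _       = λ _ → inj₁ u≡s
  ... | no _    | yes v≡t = λ _ → inj₂ v≡t

  step : List Edge → Edge → List Edge
  step acc e = if any (blockedBy? e) acc then acc else acc ++ [ e ]

  greedyScan-∷ : ∀ acc e es → greedyScan acc (e ∷ es) ≡ greedyScan (step acc e) es
  greedyScan-∷ acc (s , t) es = sym (if-float (λ acc′ → greedyScan acc′ es) (any (blockedBy? (s , t)) acc))

  greedyScan-⊇ : ∀ acc es {x} → x ∈ acc → x ∈ greedyScan acc es
  greedyScan-⊇ acc [] m = m
  greedyScan-⊇ acc ((s , t) ∷ es) m with any (blockedBy? (s , t)) acc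
  ... | true  = greedyScan-⊇ acc es m
  ... | false = greedyScan-⊇ (acc ++ [ s , t ]) es (∈-++⁺ˡ m)

  module Restriction {P : Edge → Set} (P? : Decidable P) where

    BlockClosed : List Edge → Set
    BlockClosed M = ∀ {x e} → x ∈ M → P e → Blocks x e → P x

    filter-step-accept : ∀ F e → P e → BlockClosed F → filter P? (step F e) ≡ step (filter P? F) e
    filter-step-accept F e Pe closed = begin
      filter P? (if b then F else F ++ [ e ])
        ≡⟨ if-float (filter P?) b ⟩
      (if b then filter P? F else filter P? (F ++ [ e ]))
        ≡⟨ if-cong-else b (trans (filter-++ P? F [ e ]) (cong (filter P? F ++_) (filter-accept P? Pe))) ⟩
      (if b then filter P? F else filter P? F ++ [ e ])
        ≡⟨ if-cong (sym (any-filter P? (blockedBy? e) (All.tabulate blocker-inside))) ⟩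
      step (filter P? F) e ∎
      where
        open ≡-Reasoning
        b = any (blockedBy? e) F
        blocker-inside : ∀ {x} → x ∈ F → T (blockedBy? e x) → P x
        blocker-inside {x} m bl = closed m Pe (blockedBy?-sound e x bl)

    filter-step-reject : ∀ F e → ¬ P e → filter P? (step F e) ≡ filter P? F
    filter-step-reject F e ¬Pe = begin
      filter P? (if b then F else F ++ [ e ])
        ≡⟨ if-float (filter P?) b ⟩
      (if b then filter P? F else filter P? (F ++ [ e ]))
        ≡⟨ if-cong-else b filter-F++e ⟩
      (if b then filter P? F else filter P? F)
        ≡⟨ if-eta b ⟩
      filter P? F ∎
      where
        open ≡-Reasoning
        b = any (blockedBy? e) F
        filter-F++e : filter P? (F ++ [ e ]) ≡ filter P? F
        filter-F++e = begin
          filter P? (F ++ [ e ])        ≡⟨ filter-++ P? F [ e ] ⟩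
          filter P? F ++ filter P? [ e ] ≡⟨ cong (filter P? F ++_) (filter-reject P? ¬Pe) ⟩
          filter P? F ++ []             ≡⟨ ++-identityʳ (filter P? F) ⟩
          filter P? F                   ∎

    greedyScan-filter-∷ : ∀ F e es → BlockClosed F →
      greedyScan (filter P? F) (filter P? (e ∷ es)) ≡ greedyScan (filter P? (step F e)) (filter P? es)
    greedyScan-filter-∷ F e es closed = by-cases (P? e)
      where
        open ≡-Reasoning
        by-cases : Dec (P e) →
          greedyScan (filter P? F) (filter P? (e ∷ es)) ≡ greedyScan (filter P? (step F e)) (filter P? es)
        by-cases (yes Pe) = begin
          greedyScan (filter P? F) (filter P? (e ∷ es)) ≡⟨ cong (greedyScan (filter P? F)) (filter-accept P? Pe) ⟩
          greedyScan (filter P? F) (e ∷ filter P? es)   ≡⟨ greedyScan-∷ (filter P? F) e (filter P? es) ⟩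
          greedyScan (step (filter P? F) e) (filter P? es)
            ≡⟨ cong (λ acc → greedyScan acc (filter P? es)) (sym (filter-step-accept F e Pe closed)) ⟩
          greedyScan (filter P? (step F e)) (filter P? es) ∎
        by-cases (no ¬Pe) = begin
          greedyScan (filter P? F) (filter P? (e ∷ es)) ≡⟨ cong (greedyScan (filter P? F)) (filter-reject P? ¬Pe) ⟩
          greedyScan (filter P? F) (filter P? es)
            ≡⟨ cong (λ acc → greedyScan acc (filter P? es)) (sym (filter-step-reject F e ¬Pe)) ⟩
          greedyScan (filter P? (step F e)) (filter P? es) ∎

    greedyScan-filter : ∀ F es → BlockClosed (greedyScan F es) →
      greedyScan (filter P? F) (filter P? es) ≡ filter P? (greedyScan F es)
    greedyScan-filter F [] _ = refl
    greedyScan-filter F (e ∷ es) closed = begin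
      greedyScan (filter P? F) (filter P? (e ∷ es)) ≡⟨ greedyScan-filter-∷ F e es closedF ⟩
      greedyScan (filter P? (step F e)) (filter P? es)
        ≡⟨ greedyScan-filter (step F e) es (subst BlockClosed (greedyScan-∷ F e es) closed) ⟩
      filter P? (greedyScan (step F e) es)          ≡⟨ cong (filter P?) (sym (greedyScan-∷ F e es)) ⟩
      filter P? (greedyScan F (e ∷ es))             ∎
      where
        open ≡-Reasoning
        closedF : BlockClosed F
        closedF m = closed (greedyScan-⊇ F (e ∷ es) m)

  ∈?-sound : ∀ {s} S → (s ∈? S) ≡ true → s ∈ S
  ∈?-sound {s} (u ∷ S) p with u ≟s s
  ... | yes refl = here refl
  ... | no _     = there (∈?-sound S p)

  ∈?-complete : ∀ {s S} → s ∈ S → (s ∈? S) ≡ true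
  ∈?-complete {s} (here refl) with s ≟s s
  ... | yes _   = refl
  ... | no s≢s = contradiction refl s≢s
  ∈?-complete {s} {u ∷ _} (there m) with u ≟s s
  ... | yes _ = refl
  ... | no _  = ∈?-complete m

  module _ (S̄ : List Str) where

    Inside : Edge → Set
    Inside e = (tail e ∈? S̄) ≡ true × (head e ∈? S̄) ≡ true

    inside? : Decidable Inside
    inside? e = (tail e ∈? S̄) Data.Bool.≟ true ×-dec ((head e ∈? S̄) Data.Bool.≟ true)

    open Restriction inside?

    module _ {M C̄ : List Edge} (cycles : UnionOfCycles M C̄) (vertices : VerticesOf C̄ S̄) where

      inside-C̄ : ∀ {e} → e ∈ C̄ → Inside e
      inside-C̄ {u , v} e∈C̄ =
        ∈?-complete (proj₂ (vertices u) (v , inj₁ e∈C̄)) , ∈?-complete (proj₂ (vertices v) (u , inj₂ e∈C̄))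

      touching-∈-C̄ : ∀ {x} → x ∈ M → tail x ∈ S̄ ⊎ head x ∈ S̄ → x ∈ C̄
      touching-∈-C̄ {u , v} x∈M (inj₁ u∈S̄) with proj₁ (vertices u) u∈S̄
      ... | w , inj₁ uw∈C̄ = proj₂ cycles x∈M uw∈C̄ (inj₁ refl)
      ... | w , inj₂ wu∈C̄ = proj₂ cycles x∈M wu∈C̄ (inj₂ (inj₁ refl))
      touching-∈-C̄ {u , v} x∈M (inj₂ v∈S̄) with proj₁ (vertices v) v∈S̄
      ... | w , inj₁ vw∈C̄ = proj₂ cycles x∈M vw∈C̄ (inj₂ (inj₂ (inj₁ refl)))
      ... | w , inj₂ wv∈C̄ = proj₂ cycles x∈M wv∈C̄ (inj₂ (inj₂ (inj₂ refl)))

      blockClosed : BlockClosed M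
      blockClosed {_ , _} {_ , _} x∈M (s∈S̄ , _) (inj₁ refl) =
        inside-C̄ (touching-∈-C̄ x∈M (inj₁ (∈?-sound S̄ s∈S̄)))
      blockClosed {_ , _} {_ , _} x∈M (_ , t∈S̄) (inj₂ refl) =
        inside-C̄ (touching-∈-C̄ x∈M (inj₂ (∈?-sound S̄ t∈S̄)))

mainTheorem3 : {A : Set} (_≟_ : DecidableEquality A) →
    let open Strings _≟_ in
    (S : List Str) (E : List Edge) (C̄ : List Edge) (S̄ : List Str) →
    Unique S → SubstringFree S →
    IsMGreedyOrder S E →
    UnionOfCycles (mgreedy E) C̄ →
    VerticesOf C̄ S̄ →
    ∀ e → ((e ∈ mgreedy (restrictOrder S̄ E) → e ∈ C̄) × (e ∈ C̄ → e ∈ mgreedy (restrictOrder S̄ E)))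
mainTheorem3 _≟_ S E C̄ S̄ _ _ _ cycles vertices e = sound , complete
  where
    open Strings _≟_
    open MGreedy _≟_
    open Restriction (inside? S̄)

    restricted : mgreedy (restrictOrder S̄ E) ≡ filter (inside? S̄) (mgreedy E)
    restricted = greedyScan-filter [] E (blockClosed S̄ cycles vertices)

    sound : e ∈ mgreedy (restrictOrder S̄ E) → e ∈ C̄
    sound e∈R with ∈-filter⁻ (inside? S̄) (subst (e ∈_) restricted e∈R)
    ... | e∈M , (te∈S̄ , _) = touching-∈-C̄ S̄ cycles vertices e∈M (inj₁ (∈?-sound S̄ te∈S̄))

    complete : e ∈ C̄ → e ∈ mgreedy (restrictOrder S̄ E)
    complete e∈C̄ =
      subst (e ∈_) (sym restricted) (∈-filter⁺ (inside? S̄) (proj₁ cycles e∈C̄) (inside-C̄ S̄ cycles vertices e∈C̄))
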